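{- Let $q=p_1\cdots p_k$ be a product of $k$ pairwise distinct primes. Let $P:\mathcal X\times\mathcal Y\to\{0,1\}$ be a predicate with $|\mathcal X|=|\mathcal Y|=n$ such that every matrix $F$ that represents $P$ modulo $q$ is (with respect to some fixed ordering of $\mathcal X$ and $\mathcal Y$) an $n\times n$ triangular matrix all of whose entries on the main diagonal are non-zero modulo $q$. Then $\mathrm{DI}(P,q)\ge n/k$.
   Context: A predicate is a function $P:\mathcal X\times\mathcal Y\to\{0,1\}$ with $\mathcal X,\mathcal Y$ finite nonempty sets. For an integer $q\ge 2$, a matrix $F\in\mathbb Z_q^{\mathcal X\times\mathcal Y}$ represents $P$ modulo $q$ if for all $x,y$: $F_{x,y}\equiv 0\pmod q$ iff $P(x,y)=1$. An inner product encoding of $P$ modulo $q$ of length $\ell$ is a pair of maps $x\mapsto \vec x\in\mathbb Z_q^\ell$, $y\mapsto\vec y\in\mathbb Z_q^\ell$ such that for all $x\in\mathcal X,y\in\mathcal Y$: $P(x,y)=1$ iff $\sum_{i=1}^\ell \vec x_i\vec y_i\equiv 0\pmod q$. $\mathrm{DI}(P,q)$ is the minimum length of such an encoding. -}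

module Defs where

open import Data.Nat using (ℕ; zero; suc; _<_)
open import Data.Nat.Primality using (Prime)
open import Data.Integer using (ℤ; +_; _+_; _*_)
open import Data.Integer.Divisibility using (_∣_)
open import Data.Fin using (Fin; toℕ) renaming (zero to fzero; suc to fsuc)
open import Data.Bool using (Bool; true)
open import Data.Product using (_×_)
open import Data.Sum using (_⊎_)
open import Data.Nat.ListAction using (product)
open import Data.Vec.Functional using (Vector; toList)
open import Function.Bundles using (_↔_; Inverse)
open import Function.Definitions using (Injective)
open import Relation.Binary.PropositionalEquality using (_≡_)
open import Relation.Nullary using (¬_)

-- "a ≡ 0 (mod q)" for an integer a and a natural modulus q.
-- Elements of ℤ_q are represented by integers, congruence taken mod q.
_≡0mod_ : ℤ → ℕ → Set
a ≡0mod q = (+ q) ∣ a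

ip : ∀ {ℓ} → (Fin ℓ → ℤ) → (Fin ℓ → ℤ) → ℤ
ip {zero}  u v = + 0
ip {suc ℓ} u v = u fzero * v fzero + ip (λ i → u (fsuc i)) (λ i → v (fsuc i))

IsProductOfDistinctPrimes : ℕ → ℕ → Set
IsProductOfDistinctPrimes q k =
  Data.Product.Σ (Vector ℕ k) λ ps →
    ((i : Fin k) → Prime (ps i)) × Injective _≡_ _≡_ ps × (q ≡ product (toList ps))

Represents : {X Y : Set} → (X → Y → Bool) → ℕ → (X → Y → ℤ) → Set
Represents {X} {Y} P q F = (x : X) (y : Y) → (F x y ≡0mod q → P x y ≡ true) × (P x y ≡ true → F x y ≡0mod q)

record IPEncoding {X Y : Set} (P : X → Y → Bool) (q ℓ : ℕ) : Set where
  field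
    vecX : X → (Fin ℓ → ℤ)
    vecY : Y → (Fin ℓ → ℤ)
    correct : (x : X) (y : Y) →
      (P x y ≡ true → ip (vecX x) (vecY y) ≡0mod q) × (ip (vecX x) (vecY y) ≡0mod q → P x y ≡ true)

-- DI(P,q) ≥ m  (m given as a rational a/b with b > 0, i.e. DI ≥ a/b):
-- every encoding of P modulo q has length ℓ with a ≤ b · ℓ.
DI≥ : {X Y : Set} → (X → Y → Bool) → ℕ → (a b : ℕ) → Set
DI≥ P q a b = (ℓ : ℕ) → IPEncoding P q ℓ → a Data.Nat.≤ b Data.Nat.* ℓ

UpperTriangular LowerTriangular : ∀ {n} → ℕ → (Fin n → Fin n → ℤ) → Set
UpperTriangular q M = ∀ i j → toℕ j < toℕ i → M i j ≡0mod q
LowerTriangular q M = ∀ i j → toℕ i < toℕ j → M i j ≡0mod q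

TriangularNonzeroDiag : ∀ {n} → ℕ → (Fin n → Fin n → ℤ) → Set
TriangularNonzeroDiag q M =
  (UpperTriangular q M ⊎ LowerTriangular q M) × (∀ i → ¬ (M i i ≡0mod q))

-- Fix an encoding of length ℓ and let M be the matrix of inner products ⟨x⃗, y⃗⟩; it represents P
-- modulo q, so it is triangular with diagonal entries nonzero modulo q.  For a prime p ∣ q, the
-- diagonal entries of M that are nonzero modulo p are at most ℓ in number: M = U Vᵀ has rank at
-- most ℓ over 𝔽_p, and a triangular matrix has rank at least its number of nonzero diagonal
-- entries.  Since q is squarefree, every diagonal entry is nonzero modulo one of the k primes, so
-- n ≤ k ℓ.
module Submission where

open import Defs
open import Data.Nat as ℕ using (ℕ; zero; suc; z≤n; s≤s; _≤_)
import Data.Nat.Properties as ℕ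
import Data.Nat.Divisibility as ℕ
open import Data.Nat.Primality using (Prime; euclidsLemma; prime⇒irreducible; ¬prime[1])
open import Data.Nat.ListAction using (product)
open import Data.Nat.ListAction.Properties using (∈⇒∣product)
open import Data.Integer using (ℤ; +_; _+_; _*_; _-_)
import Data.Integer as ℤ
import Data.Integer.Properties as ℤ
import Data.Integer.Divisibility.Signed as Signed
open import Data.Integer.Tactic.RingSolver using (solve-∀)
open import Data.Fin using (Fin) renaming (zero to fzero; suc to fsuc)
open import Data.Fin.Properties using (¬∀⟶∃¬)
open import Data.Fin.Subset using (Subset; inside; outside; _∈_; _⊆_; _∪_; ⋃; ⊤; ∣_∣)
open import Data.Fin.Subset.Properties using (∣⊤∣≡n; ∣⊥∣≡0; p⊆q⇒∣p∣≤∣q∣; x∈p∪q⁺)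
open import Data.Bool using (Bool)
open import Data.Vec using ([]; _∷_; here; there; tabulate)
open import Data.Vec.Properties using (lookup∘tabulate; lookup⇒[]=; []=⇒lookup)
open import Data.Vec.Functional using (Vector; removeAt; toList)
import Data.List as List
open import Data.List using ([]; _∷_)
open import Data.List.Relation.Unary.AllPairs using ([]; _∷_)
open import Data.List.Relation.Unary.All using (All; []; _∷_)
import Data.List.Relation.Unary.All.Properties as All
open import Data.List.Relation.Unary.Any using (here; there)
import Data.List.Membership.Propositional as List
import Data.List.Membership.Propositional.Properties as List
open import Data.List.Relation.Unary.Unique.Propositional using (Unique)
import Data.List.Relation.Unary.Unique.Propositional.Properties as Unique
open import Data.Product using (∃; _,_; proj₁; proj₂; swap)
open import Data.Sum using (_⊎_; inj₁; inj₂; [_,_])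
import Data.Sum as Sum
open import Data.Empty using (⊥-elim)
open import Function using (_∘_; id; _⇔_; mk⇔; Equivalence)
open import Function.Bundles using (_↔_; Inverse)
open import Function.Definitions using (Injective)
open import Relation.Nullary using (¬_; Dec; yes; no; ¬?; does)
open import Relation.Nullary.Decidable using (dec-true)
open import Level using (0ℓ)
open import Relation.Unary using (Pred; Decidable)
open import Relation.Binary.PropositionalEquality
  using (_≡_; refl; sym; trans; cong; cong₂; subst; module ≡-Reasoning)

private
  variable
    k ℓ m n p q : ℕ
    a : ℤ

≡0mod⇒∣ : a ≡0mod p → + p Signed.∣ a
≡0mod⇒∣ {a} {p} = Signed.∣ᵤ⇒∣ {+ p} {a}

∣⇒≡0mod : + p Signed.∣ a → a ≡0mod p
∣⇒≡0mod {p} {a} = Signed.∣⇒∣ᵤ {+ p} {a}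

≡0mod-0 : (+ 0) ≡0mod p
≡0mod-0 {p} = p ℕ.∣0

≡0mod-+ : ∀ a b → a ≡0mod p → b ≡0mod p → (a + b) ≡0mod p
≡0mod-+ a b p∣a p∣b = ∣⇒≡0mod (Signed.∣m∣n⇒∣m+n (≡0mod⇒∣ {a} p∣a) (≡0mod⇒∣ {b} p∣b))

≡0mod-*ˡ : ∀ a b → b ≡0mod p → (a * b) ≡0mod p
≡0mod-*ˡ a b p∣b = ∣⇒≡0mod (Signed.∣n⇒∣m*n a (≡0mod⇒∣ {b} p∣b))

sub-≡0mod⇔ : ∀ a b → b ≡0mod p → ((a - b) ≡0mod p ⇔ a ≡0mod p)
sub-≡0mod⇔ a b p∣b = mk⇔
  (λ p∣a-b → ∣⇒≡0mod {a = a}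
    (Signed.∣m+n∣n⇒∣m (≡0mod⇒∣ {a - b} p∣a-b) (Signed.∣m⇒∣-m (≡0mod⇒∣ {b} p∣b))))
  (λ p∣a → ∣⇒≡0mod (Signed.∣m∣n⇒∣m-n (≡0mod⇒∣ {a} p∣a) (≡0mod⇒∣ {b} p∣b)))

≡0mod? : ∀ a p → Dec (a ≡0mod p)
≡0mod? a p = p ℕ.∣? ℤ.∣ a ∣

prime-≡0mod-* : Prime p → ∀ a b → (a * b) ≡0mod p → a ≡0mod p ⊎ b ≡0mod p
prime-≡0mod-* pp a b p∣ab = euclidsLemma ℤ.∣ a ∣ ℤ.∣ b ∣ pp (subst (_ ℕ.∣_) (ℤ.abs-* a b) p∣ab)

ip-comm : (u v : Vector ℤ ℓ) → ip u v ≡ ip v u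
ip-comm {zero}  u v = refl
ip-comm {suc ℓ} u v =
  cong₂ _+_ (ℤ.*-comm (u fzero) (v fzero)) (ip-comm (u ∘ fsuc) (v ∘ fsuc))

ip-linearʳ : ∀ (u v w : Vector ℤ ℓ) a c → ip u (λ s → a * v s - c * w s) ≡ a * ip u v - c * ip u w
ip-linearʳ {zero}  u v w a c = 0≡a*0-c*0 a c
  where
  0≡a*0-c*0 : ∀ a c → + 0 ≡ a * + 0 - c * + 0
  0≡a*0-c*0 = solve-∀
ip-linearʳ {suc ℓ} u v w a c = begin
  u₀ * (a * v₀ - c * w₀) + ip u′ (λ s → a * v′ s - c * w′ s)
    ≡⟨ cong (λ z → u₀ * (a * v₀ - c * w₀) + z) (ip-linearʳ u′ v′ w′ a c) ⟩
  u₀ * (a * v₀ - c * w₀) + (a * ip u′ v′ - c * ip u′ w′)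
    ≡⟨ regroup a c u₀ v₀ w₀ (ip u′ v′) (ip u′ w′) ⟩
  a * (u₀ * v₀ + ip u′ v′) - c * (u₀ * w₀ + ip u′ w′)
    ∎
  where
  open ≡-Reasoning
  u₀ v₀ w₀ : ℤ
  u₀ = u fzero
  v₀ = v fzero
  w₀ = w fzero
  u′ v′ w′ : Vector ℤ ℓ
  u′ = u ∘ fsuc
  v′ = v ∘ fsuc
  w′ = w ∘ fsuc
  regroup : ∀ a c x y z X Y → x * (a * y - c * z) + (a * X - c * Y) ≡ a * (x * y + X) - c * (x * z + Y)
  regroup = solve-∀

ip-removeAt : (t : Fin (suc ℓ)) (u v : Vector ℤ (suc ℓ)) →
  ip u v ≡ u t * v t + ip (removeAt u t) (removeAt v t)
ip-removeAt fzero u v = refl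
ip-removeAt {suc ℓ} (fsuc t) u v = begin
  u fzero * v fzero + ip (u ∘ fsuc) (v ∘ fsuc)
    ≡⟨ cong (λ z → u fzero * v fzero + z) (ip-removeAt t (u ∘ fsuc) (v ∘ fsuc)) ⟩
  u fzero * v fzero + (u (fsuc t) * v (fsuc t) + ip (removeAt (u ∘ fsuc) t) (removeAt (v ∘ fsuc) t))
    ≡⟨ exchange (u fzero * v fzero) (u (fsuc t) * v (fsuc t)) _ ⟩
  u (fsuc t) * v (fsuc t) + (u fzero * v fzero + ip (removeAt (u ∘ fsuc) t) (removeAt (v ∘ fsuc) t))
    ∎
  where
  open ≡-Reasoning
  exchange : ∀ x y z → x + (y + z) ≡ y + (x + z)
  exchange = solve-∀

ip-≡0mod : (u v : Vector ℤ ℓ) → (∀ t → v t ≡0mod p) → ip u v ≡0mod p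
ip-≡0mod {zero}  u v p∣v = ≡0mod-0
ip-≡0mod {suc ℓ} u v p∣v = ≡0mod-+ (u fzero * v fzero) (ip (u ∘ fsuc) (v ∘ fsuc))
  (≡0mod-*ˡ (u fzero) (v fzero) (p∣v fzero)) (ip-≡0mod (u ∘ fsuc) (v ∘ fsuc) (p∣v ∘ fsuc))

ip≢0mod⇒∃≢0mod : (u v : Vector ℤ ℓ) → ¬ ip u v ≡0mod p → ∃ λ t → ¬ v t ≡0mod p
ip≢0mod⇒∃≢0mod {ℓ} {p} u v p∤uv = ¬∀⟶∃¬ ℓ _ (λ t → ≡0mod? (v t) p) (p∤uv ∘ ip-≡0mod u v)

eliminate : Fin (suc ℓ) → (w v : Vector ℤ (suc ℓ)) → Vector ℤ ℓ
eliminate t w v = removeAt (λ s → w t * v s - v t * w s) t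

ip-eliminate : (t : Fin (suc ℓ)) (u v w : Vector ℤ (suc ℓ)) →
  ip (removeAt u t) (eliminate t w v) ≡ w t * ip u v - v t * ip u w
ip-eliminate t u v w = begin
  ip u′ (eliminate t w v)
    ≡⟨ ip-linearʳ u′ v′ w′ (w t) (v t) ⟩
  w t * ip u′ v′ - v t * ip u′ w′
    ≡⟨ regroup (w t) (v t) (u t) (ip u′ v′) (ip u′ w′) ⟩
  w t * (u t * v t + ip u′ v′) - v t * (u t * w t + ip u′ w′)
    ≡⟨ cong₂ (λ x y → w t * x - v t * y) (ip-removeAt t u v) (ip-removeAt t u w) ⟨
  w t * ip u v - v t * ip u w
    ∎
  where
  open ≡-Reasoning
  u′ v′ w′ : Vector ℤ _
  u′ = removeAt u t
  v′ = removeAt v t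
  w′ = removeAt w t
  regroup : ∀ a b c X Y → a * X - b * Y ≡ a * (c * b + X) - b * (c * a + Y)
  regroup = solve-∀

eliminate-≡0mod⇔ : Prime p → (t : Fin (suc ℓ)) (u v w : Vector ℤ (suc ℓ)) →
  ¬ w t ≡0mod p → ip u w ≡0mod p →
  ip (removeAt u t) (eliminate t w v) ≡0mod p ⇔ ip u v ≡0mod p
eliminate-≡0mod⇔ pp t u v w p∤wt p∣uw rewrite ip-eliminate t u v w = mk⇔
  (λ p∣lhs → [ ⊥-elim ∘ p∤wt , id ]
    (prime-≡0mod-* pp (w t) (ip u v) (Equivalence.to (drop-vt-term (w t * ip u v)) p∣lhs)))
  (λ p∣uv → Equivalence.from (drop-vt-term (w t * ip u v)) (≡0mod-*ˡ (w t) (ip u v) p∣uv))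
  where
  drop-vt-term : ∀ a → ((a - v t * ip u w) ≡0mod _ ⇔ a ≡0mod _)
  drop-vt-term a = sub-≡0mod⇔ a (v t * ip u w) (≡0mod-*ˡ (v t) (ip u w) p∣uw)

ipMatrix : (U V : Fin m → Vector ℤ ℓ) → Fin m → Fin m → ℤ
ipMatrix U V i j = ip (U i) (V j)

NonzeroOnDiagonal : ℕ → (Fin m → Fin m → ℤ) → Subset m → Set
NonzeroOnDiagonal p M A = ∀ i → i ∈ A → ¬ M i i ≡0mod p

upperTriangular⇒∣A∣≤ℓ : Prime p → (U V : Fin m → Vector ℤ ℓ) (A : Subset m) →
  UpperTriangular p (ipMatrix U V) → NonzeroOnDiagonal p (ipMatrix U V) A → ∣ A ∣ ≤ ℓ
upperTriangular⇒∣A∣≤ℓ pp U V [] _ _ = z≤n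
upperTriangular⇒∣A∣≤ℓ pp U V (outside ∷ A) upper nonzero =
  upperTriangular⇒∣A∣≤ℓ pp (U ∘ fsuc) (V ∘ fsuc) A
    (λ i j j<i → upper (fsuc i) (fsuc j) (s≤s j<i)) (λ i i∈A → nonzero (fsuc i) (there i∈A))
upperTriangular⇒∣A∣≤ℓ {ℓ = zero} pp U V (inside ∷ A) upper nonzero =
  ⊥-elim (nonzero fzero here ≡0mod-0)
-- Pivot on a coordinate t with V₀ t ≢ 0 and clear it from the other columns V_j; since
-- ⟨U_i, V₀⟩ ≡ 0 for i > 0, this multiplies the remaining entries by the unit V₀ t modulo p.
upperTriangular⇒∣A∣≤ℓ {p} {ℓ = suc ℓ} pp U V (inside ∷ A) upper nonzero
  with ip≢0mod⇒∃≢0mod (U fzero) (V fzero) (nonzero fzero here)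
... | t , p∤V₀t = s≤s (upperTriangular⇒∣A∣≤ℓ pp U′ V′ A upper′ nonzero′)
  where
  U′ V′ : Fin _ → Vector ℤ ℓ
  U′ i = removeAt (U (fsuc i)) t
  V′ j = eliminate t (V fzero) (V (fsuc j))
  reduced : ∀ i j → ipMatrix U′ V′ i j ≡0mod p ⇔ ipMatrix U V (fsuc i) (fsuc j) ≡0mod p
  reduced i j = eliminate-≡0mod⇔ pp t (U (fsuc i)) (V (fsuc j)) (V fzero) p∤V₀t
    (upper (fsuc i) fzero (s≤s z≤n))
  upper′ : UpperTriangular p (ipMatrix U′ V′)
  upper′ i j j<i = Equivalence.from (reduced i j) (upper (fsuc i) (fsuc j) (s≤s j<i))
  nonzero′ : NonzeroOnDiagonal p (ipMatrix U′ V′) A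
  nonzero′ i i∈A = nonzero (fsuc i) (there i∈A) ∘ Equivalence.to (reduced i i)

triangular⇒∣A∣≤ℓ : Prime p → (U V : Fin m → Vector ℤ ℓ) (A : Subset m) →
  UpperTriangular p (ipMatrix U V) ⊎ LowerTriangular p (ipMatrix U V) →
  NonzeroOnDiagonal p (ipMatrix U V) A → ∣ A ∣ ≤ ℓ
triangular⇒∣A∣≤ℓ pp U V A (inj₁ upper) nonzero = upperTriangular⇒∣A∣≤ℓ pp U V A upper nonzero
triangular⇒∣A∣≤ℓ {p} pp U V A (inj₂ lower) nonzero = upperTriangular⇒∣A∣≤ℓ pp V U A
  (λ i j j<i → subst (_≡0mod p) (ip-comm (U j) (V i)) (lower j i j<i))
  (λ i i∈A → nonzero i i∈A ∘ subst (_≡0mod p) (ip-comm (V i) (U i)))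

triangular-∣ : p ℕ.∣ q → (M : Fin n → Fin n → ℤ) →
  UpperTriangular q M ⊎ LowerTriangular q M → UpperTriangular p M ⊎ LowerTriangular p M
triangular-∣ p∣q M = Sum.map
  (λ upper i j j<i → ℕ.∣-trans p∣q (upper i j j<i))
  (λ lower i j i<j → ℕ.∣-trans p∣q (lower i j i<j))

satisfying : {P : Pred (Fin n) 0ℓ} → Decidable P → Subset n
satisfying P? = tabulate (does ∘ P?)

module _ {P : Pred (Fin n) 0ℓ} (P? : Decidable P) where

  ∈-satisfying⁺ : ∀ {x} → P x → x ∈ satisfying P?
  ∈-satisfying⁺ {x} Px = lookup⇒[]= x _ (trans (lookup∘tabulate (does ∘ P?) x) (dec-true (P? x) Px))

  ∈-satisfying⁻ : ∀ {x} → x ∈ satisfying P? → P x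
  ∈-satisfying⁻ {x} x∈ with P? x | trans (sym (lookup∘tabulate (does ∘ P?) x)) ([]=⇒lookup x∈)
  ... | yes Px | _ = Px
  ... | no _   | ()

∣p∪q∣≤∣p∣+∣q∣ : (A B : Subset n) → ∣ A ∪ B ∣ ≤ ∣ A ∣ ℕ.+ ∣ B ∣
∣p∪q∣≤∣p∣+∣q∣ [] [] = z≤n
∣p∪q∣≤∣p∣+∣q∣ (outside ∷ A) (outside ∷ B) = ∣p∪q∣≤∣p∣+∣q∣ A B
∣p∪q∣≤∣p∣+∣q∣ (outside ∷ A) (inside ∷ B) =
  ℕ.≤-trans (s≤s (∣p∪q∣≤∣p∣+∣q∣ A B)) (ℕ.≤-reflexive (sym (ℕ.+-suc ∣ A ∣ ∣ B ∣)))
∣p∪q∣≤∣p∣+∣q∣ (inside ∷ A) (outside ∷ B) = s≤s (∣p∪q∣≤∣p∣+∣q∣ A B)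
∣p∪q∣≤∣p∣+∣q∣ (inside ∷ A) (inside ∷ B) =
  s≤s (ℕ.≤-trans (∣p∪q∣≤∣p∣+∣q∣ A B) (ℕ.+-monoʳ-≤ ∣ A ∣ (ℕ.n≤1+n ∣ B ∣)))

∣⋃∣≤k*ℓ : (A : Fin k → Subset n) → (∀ r → ∣ A r ∣ ≤ ℓ) → ∣ ⋃ (List.tabulate A) ∣ ≤ k ℕ.* ℓ
∣⋃∣≤k*ℓ {zero}  {n} A small = ℕ.≤-reflexive (∣⊥∣≡0 n)
∣⋃∣≤k*ℓ {suc k}     A small = ℕ.≤-trans (∣p∪q∣≤∣p∣+∣q∣ (A fzero) _)
  (ℕ.+-mono-≤ (small fzero) (∣⋃∣≤k*ℓ (A ∘ fsuc) (small ∘ fsuc)))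

∈⋃ : (A : Fin k → Subset n) (r : Fin k) {x : Fin n} → x ∈ A r → x ∈ ⋃ (List.tabulate A)
∈⋃ A fzero    x∈A = x∈p∪q⁺ (inj₁ x∈A)
∈⋃ A (fsuc r) x∈A = x∈p∪q⁺ (inj₂ (∈⋃ (A ∘ fsuc) r x∈A))

covering⇒n≤k*ℓ : (A : Fin k → Subset n) → (∀ x → ∃ λ r → x ∈ A r) →
  (∀ r → ∣ A r ∣ ≤ ℓ) → n ≤ k ℕ.* ℓ
covering⇒n≤k*ℓ {k} {n} {ℓ} A covered small = begin
  n                       ≡⟨ ∣⊤∣≡n n ⟨
  ∣ ⊤ {n} ∣               ≤⟨ p⊆q⇒∣p∣≤∣q∣ ⊤⊆⋃A ⟩
  ∣ ⋃ (List.tabulate A) ∣ ≤⟨ ∣⋃∣≤k*ℓ A small ⟩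
  k ℕ.* ℓ                 ∎
  where
  open ℕ.≤-Reasoning
  ⊤⊆⋃A : ⊤ ⊆ ⋃ (List.tabulate A)
  ⊤⊆⋃A {x} _ = ∈⋃ A (proj₁ (covered x)) (proj₂ (covered x))

prime∣product⇒∈ : ∀ {ps} → Prime p → All Prime ps → p ℕ.∣ product ps → p List.∈ ps
prime∣product⇒∈ pp [] p∣1 = ⊥-elim (¬prime[1] (subst Prime (ℕ.∣1⇒≡1 p∣1) pp))
prime∣product⇒∈ {ps = m ∷ ms} pp (pm ∷ pms) p∣m*ms with euclidsLemma m (product ms) pp p∣m*ms
... | inj₂ p∣ms = there (prime∣product⇒∈ pp pms p∣ms)
... | inj₁ p∣m with prime⇒irreducible pm p∣m
...   | inj₁ p≡1 = ⊥-elim (¬prime[1] (subst Prime p≡1 pp))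
...   | inj₂ p≡m = here p≡m

prime-∣-∤⇒*∣ : ∀ {d c} → Prime p → p ℕ.∣ c → d ℕ.∣ c → ¬ p ℕ.∣ d → p ℕ.* d ℕ.∣ c
prime-∣-∤⇒*∣ {p} {d} pp p∣c (ℕ.divides e refl) p∤d with euclidsLemma e d pp p∣c
... | inj₁ (ℕ.divides f refl) = ℕ.divides f (ℕ.*-assoc f p d)
... | inj₂ p∣d                = ⊥-elim (p∤d p∣d)

distinctPrimes⇒product∣ : ∀ {ps c} → All Prime ps → Unique ps → All (ℕ._∣ c) ps → product ps ℕ.∣ c
distinctPrimes⇒product∣ [] [] [] = ℕ.1∣ _
distinctPrimes⇒product∣ (pp ∷ pps) (p∉ps ∷ distinct) (p∣c ∷ ps∣c) =
  prime-∣-∤⇒*∣ pp p∣c (distinctPrimes⇒product∣ pps distinct ps∣c)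
    (All.All¬⇒¬Any p∉ps ∘ prime∣product⇒∈ pp pps)

∤product⇒∃∤ : ∀ {c} (ps : Vector ℕ k) → (∀ r → Prime (ps r)) → Injective _≡_ _≡_ ps →
  ¬ product (toList ps) ℕ.∣ c → ∃ λ r → ¬ ps r ℕ.∣ c
∤product⇒∃∤ {k} {c} ps prime distinct ∤c = ¬∀⟶∃¬ k _ (λ r → ps r ℕ.∣? c)
  (∤c ∘ distinctPrimes⇒product∣ (All.tabulate⁺ prime) (Unique.tabulate⁺ distinct) ∘ All.tabulate⁺)

ipEncoding⇒Represents : {X Y : Set} {P : X → Y → Bool} (E : IPEncoding P q ℓ) →
  Represents P q (λ x y → ip (IPEncoding.vecX E x) (IPEncoding.vecY E y))
ipEncoding⇒Represents E x y = swap (IPEncoding.correct E x y)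

theorem2 : (q k n : ℕ) → 2 ≤ q → IsProductOfDistinctPrimes q k →
    {X Y : Set} → (ordX : Fin n ↔ X) → (ordY : Fin n ↔ Y) → (P : X → Y → Bool) →
    ((F : X → Y → ℤ) → Represents P q F →
      TriangularNonzeroDiag q (λ i j → F (Inverse.to ordX i) (Inverse.to ordY j))) →
    DI≥ P q n k
theorem2 q k n _ (ps , prime , distinct , refl) ordX ordY P hyp ℓ E =
  covering⇒n≤k*ℓ A covered bounded
  where
  open IPEncoding E
  U V : Fin n → Vector ℤ ℓ
  U = vecX ∘ Inverse.to ordX
  V = vecY ∘ Inverse.to ordY
  M : Fin n → Fin n → ℤ
  M = ipMatrix U V
  triangular : TriangularNonzeroDiag q M
  triangular = hyp (λ x y → ip (vecX x) (vecY y)) (ipEncoding⇒Represents E)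
  p∤diagonal? : ∀ r → Decidable (λ i → ¬ M i i ≡0mod ps r)
  p∤diagonal? r i = ¬? (≡0mod? (M i i) (ps r))
  A : Fin k → Subset n
  A r = satisfying (p∤diagonal? r)
  covered : ∀ i → ∃ λ r → i ∈ A r
  covered i with ∤product⇒∃∤ ps prime distinct (proj₂ triangular i)
  ... | r , p∤Mii = r , ∈-satisfying⁺ (p∤diagonal? r) p∤Mii
  bounded : ∀ r → ∣ A r ∣ ≤ ℓ
  bounded r = triangular⇒∣A∣≤ℓ (prime r) U V (A r)
    (triangular-∣ (∈⇒∣product (List.∈-tabulate⁺ r)) M (proj₁ triangular))
    (λ i → ∈-satisfying⁻ (p∤diagonal? r))
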